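{- Let $G$ be a connected graph and $D$ a rooted distribution on $G$ with root $r$. Then $D$ is $r$-critical if and only if $D$ is $r$-solvable and every solution of $D$ is an $r$-critical solution.
   Context: A pebbling distribution $D$ on $G$ assigns to each vertex a non-negative integer number of pebbles. A pebbling step $[a,b]$, for adjacent $a,b$, removes two pebbles from $a$ and adds one to $b$. A rooted distribution has a fixed root vertex $r$; it is $r$-solvable if some sequence of pebbling steps starting from $D$ ends with at least one pebble on $r$, and such a sequence is called a solution of $D$. $D$ is $r$-critical (minimally $r$-solvable) if it is $r$-solvable but removing any single pebble makes it not $r$-solvable. A solution of $D$ is an $r$-critical solution if the distribution it ends with has exactly one pebble on $r$ and no pebble on any other vertex. -}

module Defs where

open import Data.Nat using (ℕ; zero; suc; _+_; _∸_; _≤_; _≥_)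
open import Data.Fin using (Fin; _≟_)
open import Data.List using (List; []; _∷_)
open import Data.Product using (_×_; _,_; Σ; ∃-syntax)
open import Relation.Nullary using (¬_; yes; no)
open import Relation.Binary.PropositionalEquality using (_≡_)
open import Relation.Binary.Construct.Closure.ReflexiveTransitive using (Star)

record Graph (n : ℕ) : Set₁ where
  field
    Adj     : Fin n → Fin n → Set
    sym     : ∀ {a b} → Adj a b → Adj b a
    irrefl  : ∀ {a} → ¬ Adj a a

open Graph public

Connected : ∀ {n} → Graph n → Set
Connected {n} G = (a b : Fin n) → Star (Adj G) a b

Distribution : ℕ → Set
Distribution n = Fin n → ℕ

update : ∀ {n} → Fin n → (ℕ → ℕ) → Distribution n → Distribution n
update v f D w with w ≟ v
... | yes _ = f (D w)
... | no  _ = D w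

-- Result of the pebbling step [a,b] (only meaningful when legal).
applyStep : ∀ {n} → Fin n → Fin n → Distribution n → Distribution n
applyStep a b D = update b suc (update a (λ k → k ∸ 2) D)

data Runs {n} (G : Graph n) : Distribution n → List (Fin n × Fin n) → Distribution n → Set where
  done : ∀ {D} → Runs G D [] D
  step : ∀ {D a b s D'} → Adj G a b → 2 ≤ D a →
         Runs G (applyStep a b D) s D' → Runs G D ((a , b) ∷ s) D'

IsSolution : ∀ {n} → Graph n → Fin n → Distribution n → List (Fin n × Fin n) → Set
IsSolution G r D s = ∃[ D' ] (Runs G D s D' × 1 ≤ D' r)

Solvable : ∀ {n} → Graph n → Fin n → Distribution n → Set
Solvable G r D = ∃[ s ] IsSolution G r D s

removePebble : ∀ {n} → Fin n → Distribution n → Distribution n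
removePebble v = update v (λ k → k ∸ 1)

Critical : ∀ {n} → Graph n → Fin n → Distribution n → Set
Critical {n} G r D =
  Solvable G r D × ((v : Fin n) → 1 ≤ D v → ¬ Solvable G r (removePebble v D))

single : ∀ {n} → Fin n → Distribution n
single r w with w ≟ r
... | yes _ = 1
... | no  _ = 0

IsCriticalSolution : ∀ {n} → Graph n → Fin n → Distribution n → List (Fin n × Fin n) → Set
IsCriticalSolution {n} G r D s =
  ∃[ D' ] (Runs G D s D' × ((w : Fin n) → D' w ≡ single r w))

-- A solution can be replayed on any distribution with pointwise more pebbles, and the surplus
-- survives to the end.  Hence, if some solution of D ends with a spare pebble, that pebble can be
-- traced back through the steps to a pebble of D whose removal leaves D solvable; conversely, if
-- D minus a pebble were solvable, replaying that solution on D would end with a spare pebble.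

module Submission where

open import Defs hiding (sym)
open import Data.Nat using (ℕ; suc; _+_; _∸_; _≤_; z≤n; s≤s)
open import Data.Nat.Properties
  using (≤-refl; ≤-reflexive; ≤-trans; ≤-antisym; <⇒≤; ≮⇒≥; 1+n≰n; n≤0⇒n≡0; m≤m+n; m≤n+m; m≤n+m∸n;
         +-identityʳ; +-monoˡ-≤; +-∸-comm; ∸-+-assoc; ∸-monoˡ-≤; ∸-monoʳ-≤; m∸n+n≡m)
open import Data.Fin using (Fin; _≟_)
open import Data.List using (List; []; _∷_)
open import Data.Product using (_×_; _,_; ∃-syntax)
open import Data.Empty using (⊥-elim)
open import Relation.Nullary using (¬_; Dec; yes; no)
open import Relation.Binary.PropositionalEquality
  using (_≡_; _≢_; ≢-sym; refl; sym; trans; cong; subst; subst₂)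
open import Function.Bundles using (_⇔_; mk⇔)

private
  variable
    n : ℕ
    G : Graph n
    r v w a b : Fin n
    C D D' E : Distribution n
    s : List (Fin n × Fin n)

infix  4 _≤ᴰ_
infixl 6 _⊕_

_≤ᴰ_ : Distribution n → Distribution n → Set
D ≤ᴰ E = ∀ w → D w ≤ E w

_⊕_ : Distribution n → Distribution n → Distribution n
(D ⊕ C) w = D w + C w

update-≡ : ∀ v f (D : Distribution n) → update v f D v ≡ f (D v)
update-≡ v f D with v ≟ v
... | yes _   = refl
... | no v≢v = ⊥-elim (v≢v refl)

update-≢ : ∀ f (D : Distribution n) → w ≢ v → update v f D w ≡ D w
update-≢ {w = w} {v = v} f D w≢v with w ≟ v
... | yes w≡v = ⊥-elim (w≢v w≡v)
... | no _    = refl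

single-≡ : (r : Fin n) → single r r ≡ 1
single-≡ r with r ≟ r
... | yes _   = refl
... | no r≢r = ⊥-elim (r≢r refl)

single-≢ : w ≢ r → single r w ≡ 0
single-≢ {w = w} {r = r} w≢r with w ≟ r
... | yes w≡r = ⊥-elim (w≢r w≡r)
... | no _    = refl

applyStep-source : a ≢ b → applyStep a b D a ≡ D a ∸ 2
applyStep-source {a = a} {b = b} {D = D} a≢b =
  trans (update-≢ suc (update a (_∸ 2) D) a≢b) (update-≡ a (_∸ 2) D)

applyStep-target : a ≢ b → applyStep a b D b ≡ suc (D b)
applyStep-target {a = a} {b = b} {D = D} a≢b =
  trans (update-≡ b suc (update a (_∸ 2) D)) (cong suc (update-≢ (_∸ 2) D (≢-sym a≢b)))

applyStep-other : w ≢ a → w ≢ b → applyStep a b D w ≡ D w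
applyStep-other {a = a} {b = b} {D = D} w≢a w≢b =
  trans (update-≢ suc (update a (_∸ 2) D) w≢b) (update-≢ (_∸ 2) D w≢a)

adj⇒≢ : Adj G a b → a ≢ b
adj⇒≢ {G = G} adj refl = irrefl G adj

update-mono : ∀ v {f g} → D ⊕ C ≤ᴰ E → f (D v) + C v ≤ g (E v) → update v f D ⊕ C ≤ᴰ update v g E
update-mono v D⊕C≤E at-v w with w ≟ v
... | yes refl = at-v
... | no _     = D⊕C≤E w

applyStep-mono : 2 ≤ D a → D ⊕ C ≤ᴰ E → applyStep a b D ⊕ C ≤ᴰ applyStep a b E
applyStep-mono {D = D} {a = a} {C = C} {E = E} {b = b} 2≤Da D⊕C≤E =
  update-mono b (update-mono a D⊕C≤E source) (s≤s (update-mono a D⊕C≤E source b))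
  where
  source : D a ∸ 2 + C a ≤ E a ∸ 2
  source = ≤-trans (≤-reflexive (sym (+-∸-comm (C a) 2≤Da))) (∸-monoˡ-≤ 2 (D⊕C≤E a))

runs-mono : Runs G D s D' → D ⊕ C ≤ᴰ E → ∃[ E' ] (Runs G E s E' × D' ⊕ C ≤ᴰ E')
runs-mono done D⊕C≤E = _ , done , D⊕C≤E
runs-mono {D = D} {C = C} (step {a = a} adj 2≤Da run) D⊕C≤E
  with runs-mono run (applyStep-mono 2≤Da D⊕C≤E)
... | E' , run' , D'⊕C≤E' = E' , step adj 2≤Ea run' , D'⊕C≤E'
  where
  2≤Ea = ≤-trans 2≤Da (≤-trans (m≤m+n (D a) (C a)) (D⊕C≤E a))

runs-deterministic : Runs G D s D' → Runs G D s E → D' ≡ E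
runs-deterministic done             done             = refl
runs-deterministic (step _ _ run₁) (step _ _ run₂) = runs-deterministic run₁ run₂

solvable-mono : D ≤ᴰ E → Solvable G r D → Solvable G r E
solvable-mono {D = D} {r = r} D≤E (s , D' , run , 1≤D'r)
  with runs-mono {C = λ _ → 0} run (λ w → subst (_≤ _) (sym (+-identityʳ (D w))) (D≤E w))
... | E' , run' , D'≤E' = s , E' , run' , ≤-trans 1≤D'r (subst (_≤ E' r) (+-identityʳ (D' r)) (D'≤E' r))

occupied⇒solvable : 1 ≤ D r → Solvable G r D
occupied⇒solvable 1≤Dr = [] , _ , done , 1≤Dr

solvable-step⁻¹ : Adj G a b → 2 ≤ D a → Solvable G r (applyStep a b D) → Solvable G r D
solvable-step⁻¹ {a = a} {b = b} adj 2≤Da (s , D' , run , 1≤D'r) =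
  (a , b) ∷ s , D' , step adj 2≤Da run , 1≤D'r

removePebble-≡ : ∀ v (D : Distribution n) → removePebble v D v ≡ D v ∸ 1
removePebble-≡ v = update-≡ v (_∸ 1)

removePebble-≢ : ∀ (D : Distribution n) → w ≢ v → removePebble v D w ≡ D w
removePebble-≢ = update-≢ (_∸ 1)

removePebble⊕single≤ᴰ : 1 ≤ D v → removePebble v D ⊕ single v ≤ᴰ D
removePebble⊕single≤ᴰ {D = D} {v = v} 1≤Dv w with w ≟ v
... | yes refl = ≤-reflexive (m∸n+n≡m 1≤Dv)
... | no _     = ≤-reflexive (+-identityʳ (D w))

removePebble-applyStep : a ≢ b → removePebble v (applyStep a b D) ≤ᴰ applyStep a b (removePebble v D)
removePebble-applyStep {a = a} {b = b} {v = v} {D = D} a≢b w = cases (w ≟ a) (w ≟ b) (w ≟ v)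
  where
  cases : Dec (w ≡ a) → Dec (w ≡ b) → Dec (w ≡ v) →
          removePebble v (applyStep a b D) w ≤ applyStep a b (removePebble v D) w
  cases (yes refl) _ (yes refl)
    rewrite removePebble-≡ a (applyStep a b D) | applyStep-source {D = D} a≢b
          | applyStep-source {D = removePebble a D} a≢b | removePebble-≡ a D
    = ≤-reflexive (trans (∸-+-assoc (D a) 2 1) (sym (∸-+-assoc (D a) 1 2)))
  cases (yes refl) _ (no w≢v)
    rewrite removePebble-≢ (applyStep a b D) w≢v | applyStep-source {D = D} a≢b
          | applyStep-source {D = removePebble v D} a≢b | removePebble-≢ D w≢v
    = ≤-refl
  cases (no w≢a) (yes refl) (yes refl)
    rewrite removePebble-≡ b (applyStep a b D) | applyStep-target {D = D} a≢b
          | applyStep-target {D = removePebble b D} a≢b | removePebble-≡ b D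
    = m≤n+m∸n (D b) 1
  cases (no w≢a) (yes refl) (no w≢v)
    rewrite removePebble-≢ (applyStep a b D) w≢v | applyStep-target {D = D} a≢b
          | applyStep-target {D = removePebble v D} a≢b | removePebble-≢ D w≢v
    = ≤-refl
  cases (no w≢a) (no w≢b) (yes refl)
    rewrite removePebble-≡ v (applyStep a b D) | applyStep-other {D = D} w≢a w≢b
          | applyStep-other {D = removePebble v D} w≢a w≢b | removePebble-≡ v D
    = ≤-refl
  cases (no w≢a) (no w≢b) (no w≢v)
    rewrite removePebble-≢ (applyStep a b D) w≢v | applyStep-other {D = D} w≢a w≢b
          | applyStep-other {D = removePebble v D} w≢a w≢b | removePebble-≢ D w≢v
    = ≤-refl

removePebble-target≤ᴰremovePebble-source : a ≢ b → removePebble b (applyStep a b D) ≤ᴰ removePebble a D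
removePebble-target≤ᴰremovePebble-source {a = a} {b = b} {D = D} a≢b w = cases (w ≟ a) (w ≟ b)
  where
  cases : Dec (w ≡ a) → Dec (w ≡ b) → removePebble b (applyStep a b D) w ≤ removePebble a D w
  cases (yes refl) _
    rewrite removePebble-≢ (applyStep a b D) a≢b | applyStep-source {D = D} a≢b | removePebble-≡ a D
    = ∸-monoʳ-≤ (D a) (s≤s z≤n)
  cases (no w≢a) (yes refl)
    rewrite removePebble-≡ b (applyStep a b D) | applyStep-target {D = D} a≢b | removePebble-≢ D w≢a
    = ≤-refl
  cases (no w≢a) (no w≢b)
    rewrite removePebble-≢ (applyStep a b D) w≢b | applyStep-other {D = D} w≢a w≢b | removePebble-≢ D w≢a
    = ≤-refl

Reducible : Graph n → Fin n → Distribution n → Set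
Reducible {n} G r D = ∃[ v ] (1 ≤ D v × Solvable G r (removePebble v D))

pebbles-before-step : a ≢ b → v ≢ b → 2 ≤ D a → 1 ≤ applyStep a b D v → 1 ≤ D v × 2 ≤ removePebble v D a
pebbles-before-step {a = a} {b = b} {v = v} {D = D} a≢b v≢b 2≤Da 1≤D₁v with v ≟ a
... | yes refl = <⇒≤ 2≤Da , subst (2 ≤_) (sym (removePebble-≡ a D)) (∸-monoˡ-≤ 1 3≤Da)
  where
  3≤Da : 3 ≤ D a
  3≤Da = subst (3 ≤_) (m∸n+n≡m 2≤Da) (+-monoˡ-≤ 2 (subst (1 ≤_) (applyStep-source a≢b) 1≤D₁v))
... | no v≢a =
  subst (1 ≤_) (applyStep-other v≢a v≢b) 1≤D₁v ,
  subst (2 ≤_) (sym (removePebble-≢ D (≢-sym v≢a))) 2≤Da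

reducible-step⁻¹ : Adj G a b → 2 ≤ D a → Reducible G r (applyStep a b D) → Reducible G r D
reducible-step⁻¹ {G = G} {a = a} {b = b} {D = D} {r = r} adj 2≤Da (v , 1≤D₁v , solvable) = cases (v ≟ b)
  where
  a≢b = adj⇒≢ {G = G} adj
  cases : Dec (v ≡ b) → Reducible G r D
  cases (yes refl) =
    a , <⇒≤ 2≤Da , solvable-mono (removePebble-target≤ᴰremovePebble-source a≢b) solvable
  cases (no v≢b) with pebbles-before-step a≢b v≢b 2≤Da 1≤D₁v
  ... | 1≤Dv , 2≤D-v,a =
    v , 1≤Dv , solvable-step⁻¹ adj 2≤D-v,a (solvable-mono (removePebble-applyStep a≢b) solvable)

reducible-runs⁻¹ : Runs G D s D' → Reducible G r D' → Reducible G r D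
reducible-runs⁻¹ done                reducible = reducible
reducible-runs⁻¹ (step adj 2≤Da run) reducible = reducible-step⁻¹ adj 2≤Da (reducible-runs⁻¹ run reducible)

irreducible⇒single : 1 ≤ D r → ¬ Reducible G r D → ∀ w → D w ≡ single r w
irreducible⇒single {D = D} {r = r} 1≤Dr irreducible w = cases (w ≟ r)
  where
  cases : Dec (w ≡ r) → D w ≡ single r w
  cases (yes refl) = trans (≤-antisym Dr≤1 1≤Dr) (sym (single-≡ r))
    where
    Dr≤1 : D r ≤ 1
    Dr≤1 = ≮⇒≥ λ 2≤Dr → irreducible
      (r , <⇒≤ 2≤Dr , occupied⇒solvable (subst (1 ≤_) (sym (removePebble-≡ r D)) (∸-monoˡ-≤ 1 2≤Dr)))
  cases (no w≢r) = trans (n≤0⇒n≡0 Dw≤0) (sym (single-≢ w≢r))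
    where
    Dw≤0 : D w ≤ 0
    Dw≤0 = ≮⇒≥ λ 1≤Dw → irreducible
      (w , 1≤Dw , occupied⇒solvable (subst (1 ≤_) (sym (removePebble-≢ D (≢-sym w≢r))) 1≤Dr))

occupied⊕single≰ᴰsingle : 1 ≤ E r → ¬ (E ⊕ single v ≤ᴰ single r)
occupied⊕single≰ᴰsingle {E = E} {r = r} {v = v} 1≤Er E⊕v≤r with v ≟ r
... | yes refl = 1+n≰n (≤-trans (+-monoˡ-≤ 1 1≤Er) Er+1≤1)
  where
  Er+1≤1 : E r + 1 ≤ 1
  Er+1≤1 = subst₂ (λ x y → E r + x ≤ y) (single-≡ r) (single-≡ r) (E⊕v≤r r)
... | no v≢r = 1+n≰n (≤-trans (m≤n+m 1 (E v)) Ev+1≤0)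
  where
  Ev+1≤0 : E v + 1 ≤ 0
  Ev+1≤0 = subst₂ (λ x y → E v + x ≤ y) (single-≡ v) (single-≢ v≢r) (E⊕v≤r v)

criticalSolution-ends-single : IsCriticalSolution G r D s → Runs G D s D' → ∀ w → D' w ≡ single r w
criticalSolution-ends-single (D'' , run'' , D''≡single) run' w
  rewrite runs-deterministic run' run'' = D''≡single w

lemma3 : ∀ {n} (G : Graph n) → Connected G → (r : Fin n) (D : Distribution n) →
         Critical G r D ⇔
           (Solvable G r D × (∀ (s : List (Fin n × Fin n)) → IsSolution G r D s → IsCriticalSolution G r D s))
lemma3 G _ r D = mk⇔ to from
  where
  to : Critical G r D → Solvable G r D × (∀ s → IsSolution G r D s → IsCriticalSolution G r D s)
  to (solvable , minimal) = solvable , λ s (D' , run , 1≤D'r) →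
    D' , run , irreducible⇒single 1≤D'r λ reducible →
      let (v , 1≤Dv , solvable-v) = reducible-runs⁻¹ run reducible in minimal v 1≤Dv solvable-v

  from : Solvable G r D × (∀ s → IsSolution G r D s → IsCriticalSolution G r D s) → Critical G r D
  from (solvable , allCritical) = solvable , λ v 1≤Dv (s , E' , run , 1≤E'r) →
    let (D' , run' , E'⊕v≤D') = runs-mono run (removePebble⊕single≤ᴰ 1≤Dv)
        1≤D'r = ≤-trans 1≤E'r (≤-trans (m≤m+n (E' r) (single v r)) (E'⊕v≤D' r))
        D'≡single = criticalSolution-ends-single (allCritical s (D' , run' , 1≤D'r)) run'
    in occupied⊕single≰ᴰsingle 1≤E'r λ w → subst (_ ≤_) (D'≡single w) (E'⊕v≤D' w)
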